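{- Let $\mathcal{N}$ be a $d$-dimensional affine net and $t\in\mathbb{N}^d$. Let $D_0=\mathbb{N}^d\setminus{\uparrow}\{t\}$ and $D_{k+1}=D_k\cap\mathrm{Pre}_\forall(D_k)$, and consider the resulting descending chain $D_0\supsetneq D_1\supsetneq\cdots$ (up to stabilisation). This chain is $(g,n_0)$-controlled for $g(x)=x+\|\mathcal{N}\|$ and $n_0=\|t\|$.
   Context: A $d$-dimensional affine net is a finite set $\mathcal{N}$ of triples $(a,A,b)\in\mathbb{N}^d\times\mathbb{N}^{d\times d}\times\mathbb{N}^d$; it defines transitions $u\to A\cdot(u-a)+b$ for $u\in\mathbb{N}^d$ and $(a,A,b)\in\mathcal{N}$ with $u-a\in\mathbb{N}^d$. $\mathbb{N}^d$ is ordered componentwise by $\sqsubseteq$; ${\uparrow}S$ is the upward closure. $\mathrm{Pre}_\forall(S)=\{x\in\mathbb{N}^d: \forall y\,(x\to y\Rightarrow y\in S)\}$. $\|u\|=\max_i|u(i)|$ and $\|\mathcal{N}\|=\max\{\|a\|:(a,A,b)\in\mathcal{N}\}$. Order ideals of $\mathbb{N}^d$ are identified with vectors $v\in(\mathbb{N}\cup\{\omega\})^d$ via $\{x: x\sqsubseteq v\}$; $\|I\|=\max\{I(i): I(i)<\omega\}$ ($0$ if none). Each downwards-closed $D$ is uniquely a finite union of pairwise incomparable ideals (canonical decomposition), and $\|D\|$ is the max of $\|I\|$ over these ideals. A chain is $(g,n_0)$-controlled if $\|D_k\|\le g^k(n_0)$ for all $k$, $g^k$ the $k$-th iterate. -}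

module Defs where

open import Data.Nat using (ℕ; zero; suc; _+_; _*_; _∸_; _≤_; _⊔_)
open import Data.Fin using (Fin)
open import Data.List using (List; tabulate; foldr; map)
open import Data.Nat.ListAction using (sum)
open import Data.List.Membership.Propositional using (_∈_)
open import Data.List.Relation.Unary.Any using (Any)
open import Data.List.Relation.Unary.All using (All)
open import Data.List.Relation.Unary.AllPairs using (AllPairs)
open import Data.Product using (Σ; ∃; _×_)
open import Relation.Nullary using (¬_)
open import Data.Unit using (⊤)
open import Data.Empty using (⊥)
open import Relation.Binary.PropositionalEquality using (_≡_)

Vecℕ : ℕ → Set
Vecℕ d = Fin d → ℕ

Mat : ℕ → Set
Mat d = Fin d → Fin d → ℕ

_⊑_ : ∀ {d} → Vecℕ d → Vecℕ d → Set
u ⊑ v = ∀ i → u i ≤ v i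

maxL : List ℕ → ℕ
maxL = foldr _⊔_ 0

‖_‖ : ∀ {d} → Vecℕ d → ℕ
‖ u ‖ = maxL (tabulate u)

_·_ : ∀ {d} → Mat d → Vecℕ d → Vecℕ d
(A · v) i = sum (tabulate (λ j → A i j * v j))

record Trans (d : ℕ) : Set where
  constructor ⟨_,_,_⟩
  field
    a : Vecℕ d
    A : Mat d
    b : Vecℕ d
open Trans public

AffineNet : ℕ → Set
AffineNet d = List (Trans d)

‖_‖ₙ : ∀ {d} → AffineNet d → ℕ
‖ N ‖ₙ = maxL (map (λ τ → ‖ a τ ‖) N)

Step : ∀ {d} → AffineNet d → Vecℕ d → Vecℕ d → Set
Step N u v = Σ _ λ τ → τ ∈ N × (a τ ⊑ u) ×
  (∀ i → v i ≡ (A τ · (λ j → u j ∸ a τ j)) i + b τ i)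

Pre∀ : ∀ {d} → AffineNet d → (Vecℕ d → Set) → Vecℕ d → Set
Pre∀ N S x = ∀ y → Step N x y → S y

chainD : ∀ {d} → AffineNet d → Vecℕ d → ℕ → Vecℕ d → Set
chainD N t zero x = ¬ (t ⊑ x)
chainD N t (suc k) x = chainD N t k x × Pre∀ N (chainD N t k) x

data ℕω : Set where
  fin : ℕ → ℕω
  ω   : ℕω

_≤ω_ : ℕω → ℕω → Set
fin m ≤ω fin n = m ≤ n
fin m ≤ω ω     = ⊤
ω     ≤ω fin n = ⊥
ω     ≤ω ω     = ⊤

-- order ideals of ℕ^d, identified with vectors in (ℕ ∪ {ω})^d
Ideal : ℕ → Set
Ideal d = Fin d → ℕω

_∈I_ : ∀ {d} → Vecℕ d → Ideal d → Set
x ∈I I = ∀ i → fin (x i) ≤ω I i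

_⊆I_ : ∀ {d} → Ideal d → Ideal d → Set
I ⊆I J = ∀ i → I i ≤ω J i

finPart : ℕω → ℕ
finPart (fin n) = n
finPart ω       = 0

‖_‖ᵢ : ∀ {d} → Ideal d → ℕ
‖ I ‖ᵢ = maxL (tabulate (λ i → finPart (I i)))

IsCanonicalDecomposition : ∀ {d} → (Vecℕ d → Set) → List (Ideal d) → Set
IsCanonicalDecomposition D Ds =
  AllPairs (λ I J → ¬ (I ⊆I J) × ¬ (J ⊆I I)) Ds ×
  (∀ x → (D x → Any (x ∈I_) Ds) × (Any (x ∈I_) Ds → D x))

NormDownLE : ∀ {d} → (Vecℕ d → Set) → ℕ → Set
NormDownLE D n = Σ _ λ Ds → IsCanonicalDecomposition D Ds × All (λ I → ‖ I ‖ᵢ ≤ n) Ds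

iter : (ℕ → ℕ) → ℕ → ℕ → ℕ
iter g zero    x = x
iter g (suc k) x = g (iter g k x)

Controlled : ∀ {d} → (ℕ → Vecℕ d → Set) → (ℕ → ℕ) → ℕ → Set
Controlled D g n₀ = ∀ k → NormDownLE (D k) (iter g k n₀)

{-# OPTIONS --safe #-}
module Submission where

-- Membership of x in D_k depends only on the cap of x at n_k = ‖t‖ + k‖N‖:
-- a transition subtracts at most ‖N‖ from any coordinate, so capping the input
-- at n_k + ‖N‖ leaves the successor above its own cap at n_k.  Hence D_k is the
-- union of the ideals {x | cap x ⊑ y} over its points y in the finite box
-- [0, n_k]^d, whose finite coordinates are all below n_k, and the maximal ones
-- among them form the canonical decomposition.

open import Defs
open import Data.Nat using (ℕ; zero; suc; _+_; _*_; _∸_; _≤_; _⊓_; z≤n; s≤s; _≤?_)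
open import Data.Nat.Properties
open import Data.Nat.ListAction using (sum)
open import Data.Fin using (Fin; zero; suc)
import Data.Fin.Properties as Fin
open import Data.List using (List; []; _∷_; [_]; tabulate; map; filter; upTo; cartesianProductWith)
open import Data.List.Properties using (foldr-preservesᵇ; foldr-preservesᵒ)
open import Data.List.Membership.Propositional using (_∈_; lose; find)
open import Data.List.Membership.Propositional.Properties
  using (∈-tabulate⁺; ∈-map⁺; ∈-filter⁻; ∈-map∘filter⁺; ∈-map∘filter⁻; ∈-upTo⁺; ∈-cartesianProductWith⁺)
open import Data.List.Relation.Binary.Subset.Propositional using (_⊆_)
open import Data.List.Relation.Binary.Subset.Propositional.Properties using (Any-resp-⊆; All-resp-⊇)
open import Data.List.Relation.Unary.Any as Any using (Any; here; there; any?)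
import Data.List.Relation.Unary.Any.Properties as Any
open import Data.List.Relation.Unary.All as All using (All; all?)
import Data.List.Relation.Unary.All.Properties as All
open import Data.List.Relation.Unary.AllPairs using (AllPairs; []; _∷_)
import Data.List.Relation.Unary.AllPairs.Properties as AllPairs
import Data.Vec.Functional as Vector
open import Data.Product using (∃-syntax; _×_; _,_; proj₁)
open import Data.Sum using (_⊎_; inj₁; inj₂; [_,_]′)
open import Data.Unit using (tt)
open import Data.Empty using (⊥-elim)
open import Function using (_∘_)
open import Relation.Binary using (Decidable)
import Relation.Unary as U
open import Relation.Nullary using (¬_; yes; no)
open import Relation.Nullary.Decidable using (¬?; _×-dec_; _→-dec_; map′; decidable-stable)
open import Relation.Binary.PropositionalEquality using (refl; sym; _≗_; cong₂; subst)

[m+n]⊓o≤m⊓o+n⊓o : ∀ m n o → (m + n) ⊓ o ≤ m ⊓ o + n ⊓ o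
[m+n]⊓o≤m⊓o+n⊓o m n o with ≤-total o m | ≤-total o n
... | inj₁ o≤m | _ = begin
  (m + n) ⊓ o   ≤⟨ m⊓n≤n (m + n) o ⟩
  o             ≡⟨ m≥n⇒m⊓n≡n o≤m ⟨
  m ⊓ o         ≤⟨ m≤m+n (m ⊓ o) (n ⊓ o) ⟩
  m ⊓ o + n ⊓ o ∎
  where open ≤-Reasoning
... | inj₂ _ | inj₁ o≤n = begin
  (m + n) ⊓ o   ≤⟨ m⊓n≤n (m + n) o ⟩
  o             ≡⟨ m≥n⇒m⊓n≡n o≤n ⟨
  n ⊓ o         ≤⟨ m≤n+m (n ⊓ o) (m ⊓ o) ⟩
  m ⊓ o + n ⊓ o ∎
  where open ≤-Reasoning
... | inj₂ m≤o | inj₂ n≤o = begin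
  (m + n) ⊓ o   ≤⟨ m⊓n≤m (m + n) o ⟩
  m + n         ≡⟨ cong₂ _+_ (m≤n⇒m⊓n≡m m≤o) (m≤n⇒m⊓n≡m n≤o) ⟨
  m ⊓ o + n ⊓ o ∎
  where open ≤-Reasoning

sum-tabulate-mono-≤ : ∀ {d} {f g : Fin d → ℕ} → (∀ j → f j ≤ g j) →
                      sum (tabulate f) ≤ sum (tabulate g)
sum-tabulate-mono-≤ {zero}  f≤g = z≤n
sum-tabulate-mono-≤ {suc d} f≤g = +-mono-≤ (f≤g zero) (sum-tabulate-mono-≤ (f≤g ∘ suc))

sum-tabulate-⊓-≤ : ∀ {d} o {f g : Fin d → ℕ} → (∀ j → f j ⊓ o ≤ g j) →
                   sum (tabulate f) ⊓ o ≤ sum (tabulate g)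
sum-tabulate-⊓-≤ {zero}  o f⊓o≤g = z≤n
sum-tabulate-⊓-≤ {suc d} o {f} f⊓o≤g =
  ≤-trans ([m+n]⊓o≤m⊓o+n⊓o (f zero) (sum (tabulate (f ∘ suc))) o)
          (+-mono-≤ (f⊓o≤g zero) (sum-tabulate-⊓-≤ o (f⊓o≤g ∘ suc)))

[c*[x∸a]]⊓m≤c*[x⊓n∸a] : ∀ c x a {m n} → m + a ≤ n → c * (x ∸ a) ⊓ m ≤ c * (x ⊓ n ∸ a)
[c*[x∸a]]⊓m≤c*[x⊓n∸a] c x a {m} {n} m+a≤n with ≤-total x n
... | inj₁ x≤n rewrite m≤n⇒m⊓n≡m x≤n = m⊓n≤m (c * (x ∸ a)) m
... | inj₂ n≤x rewrite m≥n⇒m⊓n≡n n≤x with c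
...   | zero   = z≤n
...   | suc c′ = begin
  suc c′ * (x ∸ a) ⊓ m ≤⟨ m⊓n≤n _ m ⟩
  m                    ≤⟨ m+n≤o⇒m≤o∸n m m+a≤n ⟩
  n ∸ a                ≤⟨ m≤m+n (n ∸ a) (c′ * (n ∸ a)) ⟩
  suc c′ * (n ∸ a)     ∎
  where open ≤-Reasoning

maxL-upper : ∀ {m ns} → m ∈ ns → m ≤ maxL ns
maxL-upper {m} {ns} m∈ns =
  foldr-preservesᵒ (λ x y → [ m≤n⇒m≤n⊔o y , m≤n⇒m≤o⊔n x ]′) 0 ns (inj₂ (Any.map ≤-reflexive m∈ns))

maxL-least : ∀ {n ns} → All (_≤ n) ns → maxL ns ≤ n
maxL-least = foldr-preservesᵇ ⊔-lub z≤n

‖‖-upper : ∀ {d} (u : Vecℕ d) i → u i ≤ ‖ u ‖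
‖‖-upper u i = maxL-upper (∈-tabulate⁺ i)

‖‖ₙ-upper : ∀ {d} (N : AffineNet d) {τ} → τ ∈ N → ‖ a τ ‖ ≤ ‖ N ‖ₙ
‖‖ₙ-upper N τ∈N = maxL-upper (∈-map⁺ (λ τ → ‖ a τ ‖) τ∈N)

⊑-trans : ∀ {d} {x y z : Vecℕ d} → x ⊑ y → y ⊑ z → x ⊑ z
⊑-trans x⊑y y⊑z i = ≤-trans (x⊑y i) (y⊑z i)

_⊑?_ : ∀ {d} → Decidable (_⊑_ {d})
x ⊑? y = Fin.all? (λ i → x i ≤? y i)

DownwardClosed : ∀ {d} → (Vecℕ d → Set) → Set
DownwardClosed S = ∀ {x y} → x ⊑ y → S y → S x

cap : ∀ {d} → ℕ → Vecℕ d → Vecℕ d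
cap n x i = x i ⊓ n

grid : (d n : ℕ) → List (Vecℕ d)
grid zero    n = [ Vector.[] ]
grid (suc d) n = cartesianProductWith Vector._∷_ (upTo (suc n)) (grid d n)

grid-complete : ∀ {d n} (x : Vecℕ d) → (∀ i → x i ≤ n) → ∃[ w ] w ∈ grid d n × w ≗ x
grid-complete {zero}  x x≤n = Vector.[] , here refl , λ ()
grid-complete {suc d} x x≤n with grid-complete (Vector.tail x) (x≤n ∘ suc)
... | w , w∈grid , w≗tail =
  Vector.head x Vector.∷ w ,
  ∈-cartesianProductWith⁺ Vector._∷_ (∈-upTo⁺ (s≤s (x≤n zero))) w∈grid ,
  λ { zero → refl ; (suc i) → w≗tail i }

_≤ω?_ : Decidable _≤ω_
fin m ≤ω? fin n = m ≤? n
fin m ≤ω? ω     = yes tt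
ω     ≤ω? fin n = no λ ()
ω     ≤ω? ω     = yes tt

≤ω-trans : ∀ {x y z} → x ≤ω y → y ≤ω z → x ≤ω z
≤ω-trans {fin _} {fin _} {fin _} x≤y y≤z = ≤-trans x≤y y≤z
≤ω-trans {fin _} {fin _} {ω}     _   _   = tt
≤ω-trans {fin _} {ω}     {ω}     _   _   = tt
≤ω-trans {ω}     {ω}     {ω}     _   _   = tt

_⊆I?_ : ∀ {d} → Decidable (_⊆I_ {d})
I ⊆I? J = Fin.all? (λ i → I i ≤ω? J i)

∈I-resp-⊆I : ∀ {d} {x : Vecℕ d} {I J} → I ⊆I J → x ∈I I → x ∈I J
∈I-resp-⊆I I⊆J x∈I i = ≤ω-trans (x∈I i) (I⊆J i)

uncap : ℕ → ℕ → ℕω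
uncap n m with m <? n
... | yes _ = fin m
... | no  _ = ω

uncap-sound : ∀ n m x → fin x ≤ω uncap n m → x ⊓ n ≤ m
uncap-sound n m x x≤ω with m <? n
... | yes _   = ≤-trans (m⊓n≤m x n) x≤ω
... | no  m≮n = ≤-trans (m⊓n≤n x n) (≮⇒≥ m≮n)

uncap-complete : ∀ n m x → x ⊓ n ≤ m → fin x ≤ω uncap n m
uncap-complete n m x x⊓n≤m with m <? n
... | no  _   = tt
... | yes m<n with ≤-total x n
...   | inj₁ x≤n = subst (_≤ m) (m≤n⇒m⊓n≡m x≤n) x⊓n≤m
...   | inj₂ n≤x = ⊥-elim (<⇒≱ m<n (subst (_≤ m) (m≥n⇒m⊓n≡n n≤x) x⊓n≤m))

finPart-uncap : ∀ n m → finPart (uncap n m) ≤ n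
finPart-uncap n m with m <? n
... | yes m<n = <⇒≤ m<n
... | no  _   = z≤n

capIdeal : ∀ {d} → ℕ → Vecℕ d → Ideal d
capIdeal n y i = uncap n (y i)

∈-capIdeal⁻ : ∀ {d n} {x y : Vecℕ d} → x ∈I capIdeal n y → cap n x ⊑ y
∈-capIdeal⁻ {n = n} {x} {y} x∈I i = uncap-sound n (y i) (x i) (x∈I i)

∈-capIdeal⁺ : ∀ {d n} {x y : Vecℕ d} → cap n x ⊑ y → x ∈I capIdeal n y
∈-capIdeal⁺ {n = n} {x} {y} cap⊑y i = uncap-complete n (y i) (x i) (cap⊑y i)

‖capIdeal‖ᵢ≤ : ∀ {d} n (y : Vecℕ d) → ‖ capIdeal n y ‖ᵢ ≤ n
‖capIdeal‖ᵢ≤ n y = maxL-least (All.tabulate⁺ (λ i → finPart-uncap n (y i)))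

module Maximals {A : Set} {_≼_ : A → A → Set} (_≼?_ : Decidable _≼_) where

  Incomparable : A → A → Set
  Incomparable x y = ¬ (x ≼ y) × ¬ (y ≼ x)

  dropBelow : A → List A → List A
  dropBelow x = filter (λ y → ¬? (y ≼? x))

  maximals : List A → List A
  maximals []       = []
  maximals (x ∷ xs) with any? (x ≼?_) (maximals xs)
  ... | yes _ = maximals xs
  ... | no  _ = x ∷ dropBelow x (maximals xs)

  maximals-incomparable : ∀ xs → AllPairs Incomparable (maximals xs)
  maximals-incomparable []       = []
  maximals-incomparable (x ∷ xs) with any? (x ≼?_) (maximals xs)
  ... | yes _   = maximals-incomparable xs
  ... | no  x⋠ =
    All.zip (All.filter⁺ _ (All.¬Any⇒All¬ _ x⋠) , All.all-filter _ (maximals xs)) ∷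
    AllPairs.filter⁺ _ (maximals-incomparable xs)

  maximals-⊆ : ∀ xs → maximals xs ⊆ xs
  maximals-⊆ (x ∷ xs) with any? (x ≼?_) (maximals xs)
  ... | yes _ = there ∘ maximals-⊆ xs
  ... | no  _ = λ { (here refl) → here refl ; (there y∈) → there (maximals-⊆ xs (proj₁ (∈-filter⁻ _ y∈))) }

  module _ {P : A → Set} (P-mono : ∀ {x y} → x ≼ y → P x → P y) where

    dropBelow-cover : ∀ x ys → Any P ys → P x ⊎ Any P (dropBelow x ys)
    dropBelow-cover x ys p with Any.filter⁺ _ p
    ... | inj₁ p′    = inj₂ p′
    ... | inj₂ ¬¬y≼x = inj₁ (P-mono (decidable-stable (_ ≼? x) ¬¬y≼x) (Any.lookup-result p))

    maximals-cover : ∀ xs → Any P xs → Any P (maximals xs)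
    maximals-cover (x ∷ xs) p with any? (x ≼?_) (maximals xs) | p
    ... | yes x≼ | here px  = Any.map (λ x≼y → P-mono x≼y px) x≼
    ... | yes _  | there p′ = maximals-cover xs p′
    ... | no  _  | here px  = here px
    ... | no  _  | there p′ = [ here , there ]′ (dropBelow-cover x (maximals xs) (maximals-cover xs p′))

capDetermined⇒NormDownLE : ∀ {d} {D : Vecℕ d → Set} n → DownwardClosed D → U.Decidable D →
                           (∀ x → D (cap n x) → D x) → NormDownLE D n
capDetermined⇒NormDownLE {d} {D} n D-closed D? D-cap =
  maximals ideals ,
  (maximals-incomparable ideals , λ x → covered x , sound x) ,
  All-resp-⊇ (maximals-⊆ ideals) (All.map⁺ (All.universal (‖capIdeal‖ᵢ≤ n) _))
  where
  open Maximals _⊆I?_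

  ideals : List (Ideal d)
  ideals = map (capIdeal n) (filter D? (grid d n))

  covered : ∀ x → D x → Any (x ∈I_) (maximals ideals)
  covered x Dx with grid-complete (cap n x) (λ i → m⊓n≤n (x i) n)
  ... | w , w∈grid , w≗cap = maximals-cover ∈I-resp-⊆I ideals (lose I∈ideals x∈I)
    where
    w⊑x : w ⊑ x
    w⊑x i = subst (_≤ x i) (sym (w≗cap i)) (m⊓n≤m (x i) n)
    I∈ideals : capIdeal n w ∈ ideals
    I∈ideals = ∈-map∘filter⁺ (capIdeal n) D? (w , w∈grid , refl , D-closed w⊑x Dx)
    x∈I : x ∈I capIdeal n w
    x∈I = ∈-capIdeal⁺ (λ i → ≤-reflexive (sym (w≗cap i)))

  sound : ∀ x → Any (x ∈I_) (maximals ideals) → D x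
  sound x p with find (Any-resp-⊆ (maximals-⊆ ideals) p)
  ... | I , I∈ideals , x∈I with ∈-map∘filter⁻ (capIdeal n) D? {xs = grid d n} I∈ideals
  ...   | y , _ , refl , Dy = D-cap x (D-closed (∈-capIdeal⁻ x∈I) Dy)

fire : ∀ {d} → Trans d → Vecℕ d → Vecℕ d
fire τ u i = (A τ · (λ j → u j ∸ a τ j)) i + b τ i

fire-mono : ∀ {d} (τ : Trans d) {x y} → x ⊑ y → fire τ x ⊑ fire τ y
fire-mono τ x⊑y i =
  +-monoˡ-≤ (b τ i) (sum-tabulate-mono-≤ λ j → *-monoʳ-≤ (A τ i j) (∸-monoˡ-≤ (a τ j) (x⊑y j)))

-- Capping the input at n can only turn a summand A i j * (x j ∸ a j) into a
-- value ≥ n ∸ a j ≥ m, and _⊓ m is subadditive.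
cap-fire : ∀ {d} (τ : Trans d) {m n} x → m + ‖ a τ ‖ ≤ n → cap m (fire τ x) ⊑ fire τ (cap n x)
cap-fire τ {m} {n} x m+‖a‖≤n i =
  ≤-trans ([m+n]⊓o≤m⊓o+n⊓o _ (b τ i) m)
    (+-mono-≤ (sum-tabulate-⊓-≤ m λ j → [c*[x∸a]]⊓m≤c*[x⊓n∸a] (A τ i j) (x j) (a τ j) (m+a≤n j))
              (m⊓n≤m (b τ i) m))
  where
  m+a≤n : ∀ j → m + a τ j ≤ n
  m+a≤n j = ≤-trans (+-monoʳ-≤ m (‖‖-upper (a τ) j)) m+‖a‖≤n

module _ {d} (N : AffineNet d) where

  fire-step : ∀ {τ x} → τ ∈ N → a τ ⊑ x → Step N x (fire τ x)
  fire-step {τ} τ∈N a⊑x = τ , τ∈N , a⊑x , λ _ → refl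

  step-⊑-fire : ∀ {x y} ((τ , _) : Step N x y) → y ⊑ fire τ x
  step-⊑-fire (τ , _ , _ , y≗) i = ≤-reflexive (y≗ i)

  Pre∀-closed : ∀ {S} → DownwardClosed S → DownwardClosed (Pre∀ N S)
  Pre∀-closed S-closed x⊑x′ pre y step@(τ , τ∈N , a⊑x , _) =
    S-closed (⊑-trans (step-⊑-fire step) (fire-mono τ x⊑x′))
             (pre _ (fire-step τ∈N (⊑-trans a⊑x x⊑x′)))

  Pre∀? : ∀ {S} → DownwardClosed S → U.Decidable S → U.Decidable (Pre∀ N S)
  Pre∀? {S} S-closed S? x =
    map′ (λ enabled⇒S y step@(_ , τ∈N , a⊑x , _) → S-closed (step-⊑-fire step) (All.lookup enabled⇒S τ∈N a⊑x))
         (λ pre → All.tabulate λ τ∈N a⊑x → pre _ (fire-step τ∈N a⊑x))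
         (all? (λ τ → a τ ⊑? x →-dec S? (fire τ x)) N)

  module _ (t : Vecℕ d) where

    chainD-closed : ∀ k → DownwardClosed (chainD N t k)
    chainD-closed zero    x⊑y t⋢y t⊑x     = t⋢y (⊑-trans t⊑x x⊑y)
    chainD-closed (suc k) x⊑y (Dy , pre) = chainD-closed k x⊑y Dy , Pre∀-closed (chainD-closed k) x⊑y pre

    chainD? : ∀ k → U.Decidable (chainD N t k)
    chainD? zero    x = ¬? (t ⊑? x)
    chainD? (suc k) x = chainD? k x ×-dec Pre∀? (chainD-closed k) (chainD? k) x

    bound : ℕ → ℕ
    bound k = iter (λ x → x + ‖ N ‖ₙ) k ‖ t ‖

    chainD-cap : ∀ k {n} → bound k ≤ n → ∀ x → chainD N t k (cap n x) → chainD N t k x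
    chainD-cap zero    bound≤n x t⋢cap t⊑x =
      t⋢cap λ i → ⊓-glb (t⊑x i) (≤-trans (‖‖-upper t i) bound≤n)
    chainD-cap (suc k) {n} bound≤n x (D-cap , pre) =
      chainD-cap k (≤-trans (m≤m+n (bound k) ‖ N ‖ₙ) bound≤n) x D-cap , successors
      where
      successors : Pre∀ N (chainD N t k) x
      successors y step@(τ , τ∈N , a⊑x , _) =
        chainD-cap k ≤-refl y (chainD-closed k capped⊑fire (pre _ (fire-step τ∈N a⊑cap)))
        where
        ‖a‖≤‖N‖ : ‖ a τ ‖ ≤ ‖ N ‖ₙ
        ‖a‖≤‖N‖ = ‖‖ₙ-upper N τ∈N

        a⊑cap : a τ ⊑ cap n x
        a⊑cap i = ⊓-glb (a⊑x i) (≤-trans (‖‖-upper (a τ) i) (≤-trans ‖a‖≤‖N‖ (≤-trans (m≤n+m _ _) bound≤n)))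

        capped⊑fire : cap (bound k) y ⊑ fire τ (cap n x)
        capped⊑fire = ⊑-trans (λ i → ⊓-monoˡ-≤ (bound k) (step-⊑-fire step i))
                              (cap-fire τ x (≤-trans (+-monoʳ-≤ (bound k) ‖a‖≤‖N‖) bound≤n))

proposition4p8 : (d : ℕ) (N : AffineNet d) (t : Vecℕ d) →
    Controlled (chainD N t) (λ x → x + ‖ N ‖ₙ) ‖ t ‖
proposition4p8 d N t k =
  capDetermined⇒NormDownLE (bound N t k) (chainD-closed N t k) (chainD? N t k) (chainD-cap N t k ≤-refl)
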